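{- Let $G$ be a Pfaffian cubic brace obtained from Pfaffian cubic braces $G_1,G_2,G_3$ by the tri-sum along a $4$-cycle $C=G_1\cap G_2\cap G_3$, and let $W=V(C)$. Then $W$ is an independent set of $G$, and for each $i$ such that $G_i-W$ is not isomorphic to $K_2$, the set $E(W,G_i-W)$ of edges of $G$ joining $W$ to $V(G_i)\setminus W$ is a matching of size four.
   Context: A cycle $C$ of $G$ is central if $G-V(C)$ has a perfect matching. Given an orientation of $G$, an even cycle is oddly oriented if, for either direction of traversal, the number of its edges directed along the traversal is odd; an orientation is Pfaffian if every central cycle is oddly oriented, and a graph is Pfaffian if it has one. A brace is a connected bipartite graph with at least 6 vertices in which every two disjoint edges lie in a common perfect matching. Tri-sum: let $G'$ be a graph containing a cycle $C$ of length $4$ such that $G'-V(C)$ has a perfect matching, and let $G_1,G_2,G_3$ be subgraphs of $G'$ with $G_i\cap G_j=C$ for $i\ne j$, $G_1\cup G_2\cup G_3=G'$, and $G_i-V(C)$ nonempty; any graph obtained from $G'$ by deleting some (possibly none) of the edges of $C$ is a tri-sum of $G_1,G_2,G_3$ (along $C$). -}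

module Defs where

open import Data.Nat using (ℕ; zero; suc; _≤_; _%_; NonZero)
open import Data.Nat.DivMod using (_mod_)
open import Data.Fin using (Fin; toℕ) renaming (zero to fz; suc to fs)
open import Data.Bool using (Bool; true; false; if_then_else_)
open import Data.Product using (Σ; ∃; _×_; _,_)
open import Data.Sum using (_⊎_)
open import Data.Empty using (⊥)
open import Relation.Nullary using (¬_)
open import Relation.Binary.PropositionalEquality using (_≡_; _≢_)

record Graph : Set where
  field
    n     : ℕ
    adj   : Fin n → Fin n → Bool
    sym   : ∀ u v → adj u v ≡ adj v u
    irrefl : ∀ v → adj v v ≡ false
open Graph public

V : Graph → Set
V G = Fin (n G)

Edge : (G : Graph) → V G → V G → Set
Edge G u v = adj G u v ≡ true

countF : ∀ {k} → (Fin k → Bool) → ℕ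
countF {zero}  f = 0
countF {suc k} f = (if f fz then 1 else 0) Data.Nat.+ countF (λ i → f (fs i))

next : ∀ {m} → Fin (suc m) → Fin (suc m)
next {m} i = suc (toℕ i) mod suc m

Cubic : Graph → Set
Cubic G = ∀ v → countF (adj G v) ≡ 3

IsPerfectMatchingOf-minus : (G : Graph) → (V G → Set) → (V G → V G → Set) → Set
IsPerfectMatchingOf-minus G X M =
  (∀ u v → M u v → Edge G u v) ×
  (∀ u v → M u v → M v u) ×
  (∀ u v → M u v → ¬ X u) ×
  (∀ v → ¬ X v → Σ (V G) λ u → M v u × (∀ u' → M v u' → u' ≡ u))

HasPerfectMatching-minus : (G : Graph) → (V G → Set) → Set₁
HasPerfectMatching-minus G X = Σ (V G → V G → Set) λ M → IsPerfectMatchingOf-minus G X M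

IsPerfectMatching : (G : Graph) → (V G → V G → Set) → Set
IsPerfectMatching G M = IsPerfectMatchingOf-minus G (λ _ → ⊥) M

-- A cycle of length suc m ≥ 3: distinct vertices vs 0 … vs m, consecutive
-- (cyclically) adjacent.
record Cycle (G : Graph) : Set where
  field
    m     : ℕ
    len≥3 : 2 ≤ m
    vs    : Fin (suc m) → V G
    inj   : ∀ i j → vs i ≡ vs j → i ≡ j
    adjc  : ∀ i → Edge G (vs i) (vs (next i))
open Cycle public

OnCycle : {G : Graph} → Cycle G → V G → Set
OnCycle C v = ∃ λ i → vs C i ≡ v

Central : (G : Graph) → Cycle G → Set₁
Central G C = HasPerfectMatching-minus G (OnCycle C)

-- D is an orientation of G (D u v = true : edge uv directed from u to v)
IsOrientation : (G : Graph) → (V G → V G → Bool) → Set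
IsOrientation G D =
  (∀ u v → D u v ≡ true → Edge G u v) ×
  (∀ u v → Edge G u v → D u v ≡ true ⊎ D v u ≡ true) ×
  (∀ u v → D u v ≡ true → D v u ≡ false)

-- even cycle with an odd number of edges directed along the traversal
-- vs 0 → vs 1 → … → vs m → vs 0 (for even cycles, the parity is the same
-- for the opposite traversal)
OddlyOriented : {G : Graph} → (V G → V G → Bool) → Cycle G → Set
OddlyOriented D C =
  (suc (m C) % 2 ≡ 0) ×
  (countF (λ i → D (vs C i) (vs C (next i))) % 2 ≡ 1)

Pfaffian : Graph → Set₁
Pfaffian G = Σ (V G → V G → Bool) λ D →
  IsOrientation G D × (∀ (C : Cycle G) → Central G C → OddlyOriented D C)

data Reach (G : Graph) : V G → V G → Set where
  here : ∀ {v} → Reach G v v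
  step : ∀ {u v w} → Edge G u v → Reach G v w → Reach G u w

Connected : Graph → Set
Connected G = ∀ u v → Reach G u v

Bipartite : Graph → Set
Bipartite G = Σ (V G → Bool) λ col → ∀ u v → Edge G u v → col u ≢ col v

Brace : Graph → Set₁
Brace G =
  Connected G × Bipartite G × (6 ≤ n G) ×
  (∀ a b c d → Edge G a b → Edge G c d →
     a ≢ c → a ≢ d → b ≢ c → b ≢ d →
     Σ (V G → V G → Set) λ M → IsPerfectMatching G M × M a b × M c d)

-- The graph H - P' where P' is the complement of P, i.e. H restricted to the
-- vertex set {u | P u}, is isomorphic to K₂ (vertices Fin 2, adjacent iff distinct).
InducedIsoK2 : (H : Graph) → (V H → Set) → Set
InducedIsoK2 H P =
  Σ (Σ (V H) P → Fin 2) λ f → Σ (Fin 2 → Σ (V H) P) λ g →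
    (∀ x → Data.Product.proj₁ (g (f x)) ≡ Data.Product.proj₁ x) ×
    (∀ k → f (g k) ≡ k) ×
    (∀ x y → (Edge H (Data.Product.proj₁ x) (Data.Product.proj₁ y) → f x ≢ f y) ×
             (f x ≢ f y → Edge H (Data.Product.proj₁ x) (Data.Product.proj₁ y)))

-- G is a tri-sum of Gs 0, Gs 1, Gs 2 along the 4-cycle
-- c 0 c 1 c 2 c 3 of an auxiliary graph G' on the same vertex set as G.
-- Each Gs i is identified with a subgraph of G' via an injective
-- edge-preserving map emb i.
record TriSum (G : Graph) (Gs : Fin 3 → Graph) : Set₁ where
  field
    adj'    : V G → V G → Bool
    sym'    : ∀ u v → adj' u v ≡ adj' v u
    irrefl' : ∀ v → adj' v v ≡ false
  G' : Graph
  G' = record { n = n G ; adj = adj' ; sym = sym' ; irrefl = irrefl' }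
  field
    c       : Fin 4 → V G
    c-inj   : ∀ k l → c k ≡ c l → k ≡ l
    c-adj   : ∀ k → adj' (c k) (c (next k)) ≡ true
  InW : V G → Set
  InW x = ∃ λ k → c k ≡ x
  CEdge : V G → V G → Set
  CEdge x y = ∃ λ k → (c k ≡ x × c (next k) ≡ y) ⊎ (c k ≡ y × c (next k) ≡ x)
  field
    G'-pm   : HasPerfectMatching-minus G' InW
    emb     : (i : Fin 3) → V (Gs i) → V G
    emb-inj : ∀ i u v → emb i u ≡ emb i v → u ≡ v
    emb-adj : ∀ i u v → Edge (Gs i) u v → adj' (emb i u) (emb i v) ≡ true
  VIn : Fin 3 → V G → Set
  VIn i x = ∃ λ u → emb i u ≡ x
  EIn : Fin 3 → V G → V G → Set
  EIn i x y = Σ (V (Gs i)) λ u → Σ (V (Gs i)) λ v →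
                emb i u ≡ x × emb i v ≡ y × Edge (Gs i) u v
  field
    -- G_i ∩ G_j = C for i ≠ j
    cap-V   : ∀ i j → i ≢ j → ∀ x → (VIn i x × VIn j x → InW x) × (InW x → VIn i x × VIn j x)
    cap-E   : ∀ i j → i ≢ j → ∀ x y →
                (EIn i x y × EIn j x y → CEdge x y) × (CEdge x y → EIn i x y × EIn j x y)
    -- G_1 ∪ G_2 ∪ G_3 = G'
    cup-V   : ∀ x → Σ (Fin 3) λ i → VIn i x
    cup-E   : ∀ x y → adj' x y ≡ true → Σ (Fin 3) λ i → EIn i x y
    nonempty : ∀ i → Σ (V (Gs i)) λ u → ¬ InW (emb i u)
    -- G is G' with some (possibly none) edges of C deleted
    G⊆G'    : ∀ x y → Edge G x y → adj' x y ≡ true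
    G'⊆G    : ∀ x y → ¬ CEdge x y → adj' x y ≡ true → Edge G x y
open TriSum public

-- the set E(W, G_i - W) of edges of G joining W to V(G_i) \ W, as ordered
-- pairs (w , x) with w ∈ W
EWG : {G : Graph} {Gs : Fin 3 → Graph} → TriSum G Gs → Fin 3 → V G → V G → Set
EWG {G} T i w x = InW T w × VIn T i x × ¬ InW T x × Edge G w x

IsMatchingOfSize4 : {G : Graph} → (V G → V G → Set) → Set
IsMatchingOfSize4 {G} E =
  Σ (Fin 4 → V G × V G) λ e →
    (∀ k → E (Data.Product.proj₁ (e k)) (Data.Product.proj₂ (e k))) ×
    (∀ w x → E w x → ∃ λ k → e k ≡ (w , x)) ×
    (∀ k l → k ≢ l →
       let (a , b) = e k ; (a' , b') = e l in
       a ≢ a' × a ≢ b' × b ≢ a' × b ≢ b')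

-- Each Gᵢ contains C, because Gᵢ ∩ Gⱼ = C.  In the cubic bipartite graph Gᵢ a
-- corner c k of C has, besides its two cycle neighbours, a third neighbour,
-- and bipartiteness puts it off C; call its image in G y i k.  The three
-- vertices y 0 k, y 1 k, y 2 k are distinct (they avoid W = Gᵢ ∩ Gⱼ), so as G
-- is cubic they are all the neighbours of c k in G: hence W is independent,
-- and E(W, Gᵢ - W) consists of the four edges c k – y i k.  These form a
-- matching as soon as y i k ≠ y i l for k ≠ l.  For adjacent corners this is
-- again bipartiteness (no triangles).  For opposite corners with a common
-- third neighbour x, the brace property forbids a perfect matching through
-- two suitable disjoint edges unless the cycle, x and the third neighbour z
-- of x are closed under adjacency; then Gᵢ - W is the edge x–z, i.e. K₂.
module Submission where

open import Defs hiding (sym)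
open import Data.Nat using (suc; _+_)
open import Data.Nat.Properties using (+-suc; suc-injective)
open import Data.Fin using (Fin; _≟_) renaming (zero to fz; suc to fs)
open import Data.Bool using (Bool; true; false; if_then_else_)
open import Data.Bool.Properties using (¬-not)
open import Data.Product using (Σ; ∃; _×_; _,_; proj₁; proj₂)
open import Data.Sum using (_⊎_; inj₁; inj₂)
open import Data.Empty using (⊥; ⊥-elim)
open import Relation.Nullary using (¬_; yes; no; does)
open import Relation.Binary.PropositionalEquality
  using (_≡_; _≢_; refl; sym; trans; cong; subst; subst₂; ≢-sym)

remove : ∀ {k} → (Fin k → Bool) → Fin k → Fin k → Bool
remove f a i = if does (i ≟ a) then false else f i

remove-keeps : ∀ {k} (f : Fin k → Bool) {a d} → f d ≡ true → d ≢ a → remove f a d ≡ true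
remove-keeps f {a} {d} fd d≢a with d ≟ a
... | yes d≡a = ⊥-elim (d≢a d≡a)
... | no _ = fd

remove-sound : ∀ {k} (f : Fin k → Bool) {a d} → remove f a d ≡ true → f d ≡ true × d ≢ a
remove-sound f {a} {d} with d ≟ a
... | yes _ = λ ()
... | no d≢a = λ fd → fd , d≢a

count-remove : ∀ {k} (f : Fin k → Bool) a → f a ≡ true → countF f ≡ suc (countF (remove f a))
count-remove f fz fa rewrite fa = refl
count-remove f (fs a) fa =
  trans (cong ((if f fz then 1 else 0) +_) (count-remove (λ i → f (fs i)) a fa))
        (+-suc (if f fz then 1 else 0) _)

count-witness : ∀ {k} (f : Fin k → Bool) {n} → countF f ≡ suc n → Σ (Fin k) λ d → f d ≡ true
count-witness {suc k} f count with f fz in f0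
... | true = fz , f0
... | false = let (d , fd) = count-witness (λ i → f (fs i)) count in fs d , fd

count-remove-suc : ∀ {k} (f : Fin k → Bool) {a n} → f a ≡ true → countF f ≡ suc n →
                   countF (remove f a) ≡ n
count-remove-suc f {a} fa count = suc-injective (trans (sym (count-remove f a fa)) count)

third-member : ∀ {k} (f : Fin k → Bool) → countF f ≡ 3 → ∀ {a b} →
               f a ≡ true → f b ≡ true → a ≢ b →
               Σ (Fin k) λ d → f d ≡ true × d ≢ a × d ≢ b
third-member f count {a} {b} fa fb a≢b =
  let f₁ = remove f a
      f₂ = remove f₁ b
      count₂ = count-remove-suc f₁ (remove-keeps f fb (≢-sym a≢b)) (count-remove-suc f fa count)
      (d , f₂d) = count-witness f₂ count₂
      (f₁d , d≢b) = remove-sound f₁ f₂d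
      (fd , d≢a) = remove-sound f f₁d
  in d , fd , d≢a , d≢b

count-zero : ∀ {k} (f : Fin k → Bool) {d} → countF f ≡ 0 → f d ≢ true
count-zero f {d} count fd with () ← trans (sym (count-remove f d fd)) count

only-three : ∀ {k} (f : Fin k → Bool) → countF f ≡ 3 → ∀ {a b c} →
             f a ≡ true → f b ≡ true → f c ≡ true → a ≢ b → a ≢ c → b ≢ c →
             ∀ d → f d ≡ true → d ≡ a ⊎ d ≡ b ⊎ d ≡ c
only-three f count {a} {b} {c} fa fb fc a≢b a≢c b≢c d fd with d ≟ a | d ≟ b | d ≟ c
... | yes d≡a | _ | _ = inj₁ d≡a
... | no _ | yes d≡b | _ = inj₂ (inj₁ d≡b)
... | no _ | no _ | yes d≡c = inj₂ (inj₂ d≡c)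
... | no d≢a | no d≢b | no d≢c = ⊥-elim (count-zero f₃ {d} count₃ f₃d)
  where
    f₁ = remove f a
    f₂ = remove f₁ b
    f₃ = remove f₂ c
    f₃d : f₃ d ≡ true
    f₃d = remove-keeps f₂ (remove-keeps f₁ (remove-keeps f fd d≢a) d≢b) d≢c
    count₃ : countF f₃ ≡ 0
    count₃ = count-remove-suc f₂ (remove-keeps f₁ (remove-keeps f fc (≢-sym a≢c)) (≢-sym b≢c))
               (count-remove-suc f₁ (remove-keeps f fb (≢-sym a≢b)) (count-remove-suc f fa count))

NeighboursAmong : (H : Graph) → V H → V H → V H → V H → Set
NeighboursAmong H v b₁ b₂ b₃ = ∀ w → Edge H v w → w ≡ b₁ ⊎ w ≡ b₂ ⊎ w ≡ b₃

among-swap : (H : Graph) {v b₁ b₂ b₃ : V H} →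
             NeighboursAmong H v b₁ b₂ b₃ → NeighboursAmong H v b₂ b₁ b₃
among-swap H N w e with N w e
... | inj₁ p = inj₂ (inj₁ p)
... | inj₂ (inj₁ p) = inj₁ p
... | inj₂ (inj₂ p) = inj₂ (inj₂ p)

cubic-neighbours : (H : Graph) → Cubic H → ∀ {v b₁ b₂ b₃} →
                   Edge H v b₁ → Edge H v b₂ → Edge H v b₃ → b₁ ≢ b₂ → b₁ ≢ b₃ → b₂ ≢ b₃ →
                   NeighboursAmong H v b₁ b₂ b₃
cubic-neighbours H cubic {v} = only-three (adj H v) (cubic v)

edge-sym : (H : Graph) {a b : V H} → Edge H a b → Edge H b a
edge-sym H {a} {b} e = trans (Graph.sym H b a) e

edge-≢ : (H : Graph) {a b : V H} → Edge H a b → a ≢ b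
edge-≢ H {a} e refl with () ← trans (sym e) (irrefl H a)

same-side : (H : Graph) ((col , proper) : Bipartite H) {a b d : V H} →
            Edge H a b → Edge H b d → col a ≡ col d
same-side H (col , proper) {a} {b} {d} ab bd =
  trans (¬-not (proper a b ab)) (sym (¬-not (≢-sym (proper b d bd))))

no-triangle : (H : Graph) → Bipartite H → {a b d : V H} →
              Edge H a b → Edge H b d → Edge H a d → ⊥
no-triangle H bip ab bd ad = proj₂ bip _ _ ad (same-side H bip ab bd)

partner : (H : Graph) {M : V H → V H → Set} → IsPerfectMatching H M →
          ∀ v → Σ (V H) (M v)
partner H (_ , _ , _ , cover) v = let (w , m , _) = cover v (λ ()) in w , m

partner-unique : (H : Graph) {M : V H → V H → Set} → IsPerfectMatching H M →
                 ∀ {v a b} → M v a → M v b → a ≡ b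
partner-unique H (_ , _ , _ , cover) {v} {a} {b} ma mb =
  let (_ , _ , unique) = cover v (λ ()) in trans (unique a ma) (sym (unique b mb))

-- If a perfect matching uses the edges t–y and x–z, then every vertex outside
-- {y, z} whose neighbours lie in {t, t', x} must be matched to t'; hence there
-- is at most one such vertex.
crowded : (H : Graph) {M : V H → V H → Set} → IsPerfectMatching H M →
          ∀ {t t' x y z p q} → M t y → M x z →
          p ≢ y → p ≢ z → NeighboursAmong H p t t' x →
          q ≢ y → q ≢ z → NeighboursAmong H q t t' x → p ≡ q
crowded H {M} pm@(in-H , M-sym , _ , _) {t} {t'} {x} {y} {z} ty xz p≢y p≢z Np q≢y q≢z Nq =
  partner-unique H pm (matched-to-t' p≢y p≢z Np) (matched-to-t' q≢y q≢z Nq)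
  where
    matched-to-t' : ∀ {a} → a ≢ y → a ≢ z → NeighboursAmong H a t t' x → M t' a
    matched-to-t' {a} a≢y a≢z Na with partner H pm a
    ... | w , aw with Na w (in-H a w aw)
    ...   | inj₁ refl = ⊥-elim (a≢y (partner-unique H pm (M-sym a w aw) ty))
    ...   | inj₂ (inj₁ refl) = M-sym a w aw
    ...   | inj₂ (inj₂ refl) = ⊥-elim (a≢z (partner-unique H pm (M-sym a w aw) xz))

closed-is-all : (H : Graph) → Connected H → (S : V H → Set) →
                (∀ {v w} → S v → Edge H v w → S w) → ∀ {a} → S a → ∀ v → S v
closed-is-all H conn S closed {a} Sa v = along (conn a v) Sa
  where
    along : ∀ {u w} → Reach H u w → S u → S w
    along here Su = Su
    along (step e r) Su = along r (closed Su e)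

edge-induces-K2 : (H : Graph) (P : V H → Set) {x z : V H} → Edge H x z → P x → P z →
                  (∀ v → P v → v ≡ x ⊎ v ≡ z) → InducedIsoK2 H P
edge-induces-K2 H P {x} {z} xz Px Pz only = toK2 , fromK2 , retract , section , adjacency
  where
    side : V H → Fin 2
    side v = if does (v ≟ x) then fz else fs fz
    side-x : side x ≡ fz
    side-x with x ≟ x
    ... | yes _ = refl
    ... | no x≢x = ⊥-elim (x≢x refl)
    side-z : side z ≡ fs fz
    side-z with z ≟ x
    ... | yes z≡x = ⊥-elim (edge-≢ H xz (sym z≡x))
    ... | no _ = refl
    toK2 : Σ (V H) P → Fin 2
    toK2 (v , _) = side v
    fromK2 : Fin 2 → Σ (V H) P
    fromK2 fz = x , Px
    fromK2 (fs _) = z , Pz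
    retract : ∀ w → proj₁ (fromK2 (toK2 w)) ≡ proj₁ w
    retract (v , Pv) with only v Pv
    ... | inj₁ refl = cong (λ s → proj₁ (fromK2 s)) side-x
    ... | inj₂ refl = cong (λ s → proj₁ (fromK2 s)) side-z
    section : ∀ s → toK2 (fromK2 s) ≡ s
    section fz = side-x
    section (fs fz) = side-z
    sides-differ : side x ≢ side z
    sides-differ e with () ← trans (sym side-x) (trans e side-z)
    adjacency : ∀ v w → (Edge H (proj₁ v) (proj₁ w) → toK2 v ≢ toK2 w) ×
                        (toK2 v ≢ toK2 w → Edge H (proj₁ v) (proj₁ w))
    adjacency (v , Pv) (w , Pw) with only v Pv | only w Pw
    ... | inj₁ refl | inj₁ refl = (λ e _ → edge-≢ H e refl) , (λ ne → ⊥-elim (ne refl))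
    ... | inj₂ refl | inj₂ refl = (λ e _ → edge-≢ H e refl) , (λ ne → ⊥-elim (ne refl))
    ... | inj₁ refl | inj₂ refl = (λ _ → sides-differ) , (λ _ → xz)
    ... | inj₂ refl | inj₁ refl = (λ _ → ≢-sym sides-differ) , (λ _ → edge-sym H xz)

opp prev : Fin 4 → Fin 4
opp k = next (next k)
prev k = next (opp k)

next-prev : ∀ k → next (prev k) ≡ k
next-prev fz = refl
next-prev (fs fz) = refl
next-prev (fs (fs fz)) = refl
next-prev (fs (fs (fs fz))) = refl



next≢prev : ∀ k → next k ≢ prev k
next≢prev fz ()
next≢prev (fs fz) ()
next≢prev (fs (fs fz)) ()
next≢prev (fs (fs (fs fz))) ()

opp≢ : ∀ k → opp k ≢ k
opp≢ fz ()
opp≢ (fs fz) ()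
opp≢ (fs (fs fz)) ()
opp≢ (fs (fs (fs fz))) ()

position : ∀ k j → j ≡ k ⊎ j ≡ next k ⊎ j ≡ prev k ⊎ j ≡ opp k
position fz fz = inj₁ refl
position fz (fs fz) = inj₂ (inj₁ refl)
position fz (fs (fs fz)) = inj₂ (inj₂ (inj₂ refl))
position fz (fs (fs (fs fz))) = inj₂ (inj₂ (inj₁ refl))
position (fs fz) fz = inj₂ (inj₂ (inj₁ refl))
position (fs fz) (fs fz) = inj₁ refl
position (fs fz) (fs (fs fz)) = inj₂ (inj₁ refl)
position (fs fz) (fs (fs (fs fz))) = inj₂ (inj₂ (inj₂ refl))
position (fs (fs fz)) fz = inj₂ (inj₂ (inj₂ refl))
position (fs (fs fz)) (fs fz) = inj₂ (inj₂ (inj₁ refl))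
position (fs (fs fz)) (fs (fs fz)) = inj₁ refl
position (fs (fs fz)) (fs (fs (fs fz))) = inj₂ (inj₁ refl)
position (fs (fs (fs fz))) fz = inj₂ (inj₁ refl)
position (fs (fs (fs fz))) (fs fz) = inj₂ (inj₂ (inj₂ refl))
position (fs (fs (fs fz))) (fs (fs fz)) = inj₂ (inj₂ (inj₁ refl))
position (fs (fs (fs fz))) (fs (fs (fs fz))) = inj₁ refl


module CubicBipartiteFourCycle (H : Graph) (cubic : Cubic H) (bip : Bipartite H)
  (a : Fin 4 → V H) (a-inj : ∀ k l → a k ≡ a l → k ≡ l)
  (a-edge : ∀ k → Edge H (a k) (a (next k))) where

  a-≢ : ∀ {k l} → k ≢ l → a k ≢ a l
  a-≢ k≢l e = k≢l (a-inj _ _ e)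

  a-edge-prev : ∀ k → Edge H (a k) (a (prev k))
  a-edge-prev k = edge-sym H (subst (λ j → Edge H (a (prev k)) (a j)) (next-prev k) (a-edge (prev k)))

  opaque
    outΣ : ∀ k → Σ (V H) λ d → Edge H (a k) d × d ≢ a (next k) × d ≢ a (prev k)
    outΣ k = third-member (adj H (a k)) (cubic (a k)) (a-edge k) (a-edge-prev k) (a-≢ (next≢prev k))

  out : Fin 4 → V H
  out k = proj₁ (outΣ k)

  out-edge : ∀ k → Edge H (a k) (out k)
  out-edge k = proj₁ (proj₂ (outΣ k))

  corner-neighbours : ∀ k → NeighboursAmong H (a k) (a (next k)) (a (prev k)) (out k)
  corner-neighbours k = cubic-neighbours H cubic (a-edge k) (a-edge-prev k) (out-edge k)
    (a-≢ (next≢prev k)) (≢-sym (proj₁ (proj₂ (proj₂ (outΣ k)))))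
    (≢-sym (proj₂ (proj₂ (proj₂ (outΣ k)))))

  -- The third neighbour is not a cycle vertex: it differs from a k and its
  -- cycle neighbours, and bipartiteness keeps it from the opposite corner.
  out-off-cycle : ∀ k j → out k ≢ a j
  out-off-cycle k j e with position k j
  ... | inj₁ refl = edge-≢ H (out-edge k) (sym e)
  ... | inj₂ (inj₁ refl) = proj₁ (proj₂ (proj₂ (outΣ k))) e
  ... | inj₂ (inj₂ (inj₁ refl)) = proj₂ (proj₂ (proj₂ (outΣ k))) e
  ... | inj₂ (inj₂ (inj₂ refl)) =
    proj₂ bip _ _ (subst (Edge H (a k)) e (out-edge k))
      (same-side H bip (a-edge k) (a-edge (next k)))

  -- Adjacent corners have different third neighbours: else a triangle.
  out-adjacent : ∀ k → out k ≢ out (next k)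
  out-adjacent k e = no-triangle H bip (a-edge k)
    (subst (Edge H (a (next k))) (sym e) (out-edge (next k))) (out-edge k)

module CubicBraceFourCycle (H : Graph) (cubic : Cubic H) (brace : Brace H)
  (a : Fin 4 → V H) (a-inj : ∀ k l → a k ≡ a l → k ≡ l)
  (a-edge : ∀ k → Edge H (a k) (a (next k))) where

  open CubicBipartiteFourCycle H cubic (proj₁ (proj₂ brace)) a a-inj a-edge public

  private
    bip = proj₁ (proj₂ brace)
    extend = proj₂ (proj₂ (proj₂ brace))

  module Opposite (k : Fin 4) (shared : out k ≡ out (opp k)) where
    p q r s x : V H
    p = a k
    q = a (opp k)
    r = a (next k)
    s = a (prev k)
    x = out k

    px : Edge H p x
    px = out-edge k
    qx : Edge H q x
    qx = subst (Edge H q) (sym shared) (out-edge (opp k))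
    p≢q : p ≢ q
    p≢q = a-≢ (≢-sym (opp≢ k))
    r≢s : r ≢ s
    r≢s = a-≢ (next≢prev k)
    x≢ : ∀ j → x ≢ a j
    x≢ = out-off-cycle k

    Np : NeighboursAmong H p r s x
    Np = cubic-neighbours H cubic (a-edge k) (a-edge-prev k) px r≢s
           (≢-sym (x≢ (next k))) (≢-sym (x≢ (prev k)))
    Nq : NeighboursAmong H q r s x
    Nq = cubic-neighbours H cubic (edge-sym H (a-edge (next k))) (a-edge (opp k)) qx r≢s
           (≢-sym (x≢ (next k))) (≢-sym (x≢ (prev k)))

    opaque
      zΣ : Σ (V H) λ d → adj H x d ≡ true × d ≢ p × d ≢ q
      zΣ = third-member (adj H x) (cubic x) (edge-sym H px) (edge-sym H qx) p≢q

    z : V H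
    z = proj₁ zΣ
    xz : Edge H x z
    xz = proj₁ (proj₂ zΣ)
    z≢p : z ≢ p
    z≢p = proj₁ (proj₂ (proj₂ zΣ))
    z≢q : z ≢ q
    z≢q = proj₂ (proj₂ (proj₂ zΣ))
    z≢r : z ≢ r
    z≢r e = no-triangle H bip (a-edge k) (edge-sym H (subst (Edge H x) e xz)) px
    z≢s : z ≢ s
    z≢s e = no-triangle H bip (a-edge-prev k) (edge-sym H (subst (Edge H x) e xz)) px

    z-off-cycle : ∀ j → z ≢ a j
    z-off-cycle j with position k j
    ... | inj₁ refl = z≢p
    ... | inj₂ (inj₁ refl) = z≢r
    ... | inj₂ (inj₂ (inj₁ refl)) = z≢s
    ... | inj₂ (inj₂ (inj₂ refl)) = z≢q

    -- If t is a cycle neighbour of p whose third neighbour y is not z, a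
    -- perfect matching through t–y and x–z would have to match both p and
    -- q to the remaining neighbour t'.
    blocked : ∀ {t t' y} → Edge H p t → Edge H t y → y ≢ z →
              t ≢ x → t ≢ z → y ≢ p → y ≢ q →
              NeighboursAmong H p t t' x → NeighboursAmong H q t t' x → ⊥
    blocked {t} {t'} {y} pt ty y≢z t≢x t≢z y≢p y≢q Np' Nq' =
      let (M , pm , Mty , Mxz) = extend t y x z ty xz t≢x t≢z y≢x y≢z
      in p≢q (crowded H pm Mty Mxz (≢-sym y≢p) (≢-sym z≢p) Np' (≢-sym y≢q) (≢-sym z≢q) Nq')
      where
        y≢x : y ≢ x
        y≢x e = no-triangle H bip pt (subst (Edge H t) e ty) px

    -- Otherwise {p, q, r, s, x, z} is closed under adjacency, so it is all of H.
    Spanned : V H → Set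
    Spanned v = v ≡ p ⊎ v ≡ q ⊎ v ≡ r ⊎ v ≡ s ⊎ v ≡ x ⊎ v ≡ z

    spanned-all : out (next k) ≡ z → out (prev k) ≡ z → ∀ v → Spanned v
    spanned-all rz sz = closed-is-all H (proj₁ brace) Spanned closed (inj₁ refl)
      where
        Sp = inj₁ refl
        Sq = inj₂ (inj₁ refl)
        Sr = inj₂ (inj₂ (inj₁ refl))
        Ss = inj₂ (inj₂ (inj₂ (inj₁ refl)))
        Sx = inj₂ (inj₂ (inj₂ (inj₂ (inj₁ refl))))
        Sz = inj₂ (inj₂ (inj₂ (inj₂ (inj₂ refl))))
        into : ∀ {v w b₁ b₂ b₃} → Spanned b₁ → Spanned b₂ → Spanned b₃ →
               NeighboursAmong H v b₁ b₂ b₃ → Edge H v w → Spanned w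
        into S₁ S₂ S₃ N e with N _ e
        ... | inj₁ refl = S₁
        ... | inj₂ (inj₁ refl) = S₂
        ... | inj₂ (inj₂ refl) = S₃
        rz-edge : Edge H r z
        rz-edge = subst (Edge H r) rz (out-edge (next k))
        sz-edge : Edge H s z
        sz-edge = subst (Edge H s) sz (out-edge (prev k))
        Nr : NeighboursAmong H r q p z
        Nr = cubic-neighbours H cubic (a-edge (next k)) (edge-sym H (a-edge k)) rz-edge
               (≢-sym p≢q) (≢-sym z≢q) (≢-sym z≢p)
        Ns : NeighboursAmong H s p q z
        Ns = cubic-neighbours H cubic (edge-sym H (a-edge-prev k)) (edge-sym H (a-edge (opp k)))
               sz-edge p≢q (≢-sym z≢p) (≢-sym z≢q)
        Nx : NeighboursAmong H x p q z
        Nx = cubic-neighbours H cubic (edge-sym H px) (edge-sym H qx) xz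
               p≢q (≢-sym z≢p) (≢-sym z≢q)
        Nz : NeighboursAmong H z r s x
        Nz = cubic-neighbours H cubic (edge-sym H rz-edge) (edge-sym H sz-edge) (edge-sym H xz)
               r≢s (≢-sym (x≢ (next k))) (≢-sym (x≢ (prev k)))
        closed : ∀ {v w} → Spanned v → Edge H v w → Spanned w
        closed (inj₁ refl) = into Sr Ss Sx Np
        closed (inj₂ (inj₁ refl)) = into Sr Ss Sx Nq
        closed (inj₂ (inj₂ (inj₁ refl))) = into Sq Sp Sz Nr
        closed (inj₂ (inj₂ (inj₂ (inj₁ refl)))) = into Sp Sq Sz Ns
        closed (inj₂ (inj₂ (inj₂ (inj₂ (inj₁ refl))))) = into Sp Sq Sz Nx
        closed (inj₂ (inj₂ (inj₂ (inj₂ (inj₂ refl))))) = into Sr Ss Sx Nz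

    collapse : (P : V H → Set) → (∀ j → ¬ P (a j)) → (∀ v → (∀ j → v ≢ a j) → P v) →
               InducedIsoK2 H P
    collapse P P-corner P-off with out (next k) ≟ z | out (prev k) ≟ z
    ... | no r≢z | _ = ⊥-elim (blocked (a-edge k) (out-edge (next k)) r≢z
                          (≢-sym (x≢ (next k))) (≢-sym z≢r)
                          (out-off-cycle (next k) k) (out-off-cycle (next k) (opp k)) Np Nq)
    ... | yes _ | no s≢z = ⊥-elim (blocked (a-edge-prev k) (out-edge (prev k)) s≢z
                          (≢-sym (x≢ (prev k))) (≢-sym z≢s)
                          (out-off-cycle (prev k) k) (out-off-cycle (prev k) (opp k))
                          (among-swap H Np) (among-swap H Nq))
    ... | yes rz | yes sz = edge-induces-K2 H P xz (P-off x x≢) (P-off z z-off-cycle) off-cycle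
      where
        off-cycle : ∀ v → P v → v ≡ x ⊎ v ≡ z
        off-cycle v Pv with spanned-all rz sz v
        ... | inj₁ refl = ⊥-elim (P-corner k Pv)
        ... | inj₂ (inj₁ refl) = ⊥-elim (P-corner (opp k) Pv)
        ... | inj₂ (inj₂ (inj₁ refl)) = ⊥-elim (P-corner (next k) Pv)
        ... | inj₂ (inj₂ (inj₂ (inj₁ refl))) = ⊥-elim (P-corner (prev k) Pv)
        ... | inj₂ (inj₂ (inj₂ (inj₂ (inj₁ refl)))) = inj₁ refl
        ... | inj₂ (inj₂ (inj₂ (inj₂ (inj₂ refl)))) = inj₂ refl

  out-injective : (P : V H → Set) → (∀ j → ¬ P (a j)) → (∀ v → (∀ j → v ≢ a j) → P v) →
                  ¬ InducedIsoK2 H P → ∀ k l → k ≢ l → out k ≢ out l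
  out-injective P P-corner P-off notK2 k l k≢l e with position k l
  ... | inj₁ refl = k≢l refl
  ... | inj₂ (inj₁ refl) = out-adjacent k e
  ... | inj₂ (inj₂ (inj₁ refl)) = out-adjacent l (trans (sym e) (cong out (sym (next-prev k))))
  ... | inj₂ (inj₂ (inj₂ refl)) = notK2 (Opposite.collapse k e P P-corner P-off)

module TriSumCorners {G : Graph} {Gs : Fin 3 → Graph} (T : TriSum G Gs) (cubicG : Cubic G)
  (cubic : ∀ i → Cubic (Gs i)) (brace : ∀ i → Brace (Gs i)) where

  other : Fin 3 → Fin 3
  other fz = fs fz
  other (fs _) = fz

  other≢ : ∀ i → i ≢ other i
  other≢ fz ()
  other≢ (fs _) ()

  -- C lies in every Gᵢ, as G_i ∩ G_j = C; corner i k is the copy of c k.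
  corner-in : ∀ i k → VIn T i (c T k)
  corner-in i k = proj₁ (proj₂ (cap-V T i (other i) (other≢ i) (c T k)) (k , refl))

  corner : ∀ i → Fin 4 → V (Gs i)
  corner i k = proj₁ (corner-in i k)

  corner-emb : ∀ i k → emb T i (corner i k) ≡ c T k
  corner-emb i k = proj₂ (corner-in i k)

  corner-inj : ∀ i k l → corner i k ≡ corner i l → k ≡ l
  corner-inj i k l e = c-inj T k l (trans (sym (corner-emb i k)) (trans (cong (emb T i) e) (corner-emb i l)))

  corner-edge : ∀ i k → Edge (Gs i) (corner i k) (corner i (next k))
  corner-edge i k =
    let (u , v , eu , ev , uv) = proj₁ (proj₂ (cap-E T i (other i) (other≢ i) (c T k) (c T (next k)))
                                          (k , inj₁ (refl , refl)))
    in subst₂ (Edge (Gs i)) (emb-inj T i _ _ (trans eu (sym (corner-emb i k))))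
                            (emb-inj T i _ _ (trans ev (sym (corner-emb i (next k))))) uv

  module Local (i : Fin 3) =
    CubicBraceFourCycle (Gs i) (cubic i) (brace i) (corner i) (corner-inj i) (corner-edge i)

  OffW : (i : Fin 3) → V (Gs i) → Set
  OffW i v = ¬ InW T (emb T i v)

  corner-not-off : ∀ i j → ¬ OffW i (corner i j)
  corner-not-off i j off = off (j , sym (corner-emb i j))

  off-cycle-is-off : ∀ i v → (∀ j → v ≢ corner i j) → OffW i v
  off-cycle-is-off i v off (j , e) = off j (emb-inj T i _ _ (trans (sym e) (sym (corner-emb i j))))

  y : Fin 3 → Fin 4 → V G
  y i k = emb T i (Local.out i k)

  y-off-W : ∀ i k → ¬ InW T (y i k)
  y-off-W i k = off-cycle-is-off i _ (Local.out-off-cycle i k)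

  -- c k – y i k is not an edge of C, so it survives in G.
  y-edge : ∀ i k → Edge G (c T k) (y i k)
  y-edge i k = G'⊆G T (c T k) (y i k) not-C-edge
    (subst (λ w → adj' T w (y i k) ≡ true) (corner-emb i k) (emb-adj T i _ _ (Local.out-edge i k)))
    where
      not-C-edge : ¬ CEdge T (c T k) (y i k)
      not-C-edge (j , inj₁ (_ , e)) = y-off-W i k (next j , e)
      not-C-edge (j , inj₂ (e , _)) = y-off-W i k (j , e)

  -- Neighbours of c k in different Gᵢ differ, since Gᵢ ∩ Gⱼ = C.
  y-distinct : ∀ i j k → i ≢ j → y i k ≢ y j k
  y-distinct i j k i≢j e =
    y-off-W i k (proj₁ (cap-V T i j i≢j (y i k)) ((_ , refl) , (_ , sym e)))

  c-neighbours : ∀ k v → Edge G (c T k) v → Σ (Fin 3) λ i → v ≡ y i k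
  c-neighbours k v e with cubic-neighbours G cubicG (y-edge fz k) (y-edge (fs fz) k) (y-edge (fs (fs fz)) k)
                            (y-distinct _ _ k λ ()) (y-distinct _ _ k λ ()) (y-distinct _ _ k λ ()) v e
  ... | inj₁ p = fz , p
  ... | inj₂ (inj₁ p) = fs fz , p
  ... | inj₂ (inj₂ p) = fs (fs fz) , p

  W-independent : ∀ w w' → InW T w → InW T w' → adj G w w' ≡ false
  W-independent _ _ (k , refl) (l , refl) with adj G (c T k) (c T l) in e
  ... | false = refl
  ... | true = let (i , eq) = c-neighbours k (c T l) e in ⊥-elim (y-off-W i k (l , eq))

  W-to-Gᵢ-matching : ∀ i → ¬ InducedIsoK2 (Gs i) (OffW i) → IsMatchingOfSize4 {G} (EWG T i)
  W-to-Gᵢ-matching i notK2 = (λ k → c T k , y i k) , member , complete , disjoint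
    where
      member : ∀ k → EWG T i (c T k) (y i k)
      member k = (k , refl) , (_ , refl) , y-off-W i k , y-edge i k
      complete : ∀ w v → EWG T i w v → ∃ λ k → (c T k , y i k) ≡ (w , v)
      complete _ v ((k , refl) , v∈Gᵢ , v∉W , e) with c-neighbours k v e
      ... | j , refl with i ≟ j
      ...   | yes refl = k , refl
      ...   | no i≢j = ⊥-elim (v∉W (proj₁ (cap-V T i j i≢j v) (v∈Gᵢ , (_ , refl))))
      disjoint : ∀ k l → k ≢ l → c T k ≢ c T l × c T k ≢ y i l × y i k ≢ c T l × y i k ≢ y i l
      disjoint k l k≢l =
        (λ e → k≢l (c-inj T k l e)) , (λ e → y-off-W i l (k , e)) , (λ e → y-off-W i k (l , sym e)) ,
        (λ e → Local.out-injective i (OffW i) (corner-not-off i) (off-cycle-is-off i) notK2 k l k≢l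
                 (emb-inj T i _ _ e))

proposition2p8 : (G : Graph) (Gs : Fin 3 → Graph) (T : TriSum G Gs) →
    Pfaffian G → Cubic G → Brace G →
    (∀ i → Pfaffian (Gs i) × Cubic (Gs i) × Brace (Gs i)) →
    (∀ w w' → InW T w → InW T w' → adj G w w' ≡ false) ×
    (∀ i → ¬ InducedIsoK2 (Gs i) (λ u → ¬ InW T (emb T i u)) →
       IsMatchingOfSize4 {G} (EWG T i))
proposition2p8 G Gs T _ cubicG _ hyps = W-independent , W-to-Gᵢ-matching
  where
    open TriSumCorners T cubicG (λ i → proj₁ (proj₂ (hyps i))) (λ i → proj₂ (proj₂ (hyps i)))
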